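{- There exists a sequence $\omega\colon\mathbb{N}\to\{0,1\}$ which is almost periodic but not eventually strongly almost periodic.
   Context: For a sequence $\omega\colon\mathbb{N}\to\Sigma$ over a finite alphabet $\Sigma$, write $\omega[i,j]=\omega(i)\omega(i+1)\dots\omega(j)$ and $\omega[i,\infty)$ for the suffix $\omega(i)\omega(i+1)\dots$. A nonempty finite string $x$ is a factor of $\omega$ if $x=\omega[i,j]$ for some $i\le j$; a factor of length $l$ is a string $\omega[i,i+l-1]$. The sequence $\omega$ is almost periodic if for every factor $x$ of $\omega$ that occurs in $\omega$ infinitely many times there is a number $l$ such that every factor of $\omega$ of length $l$ contains an occurrence of $x$. It is strongly almost periodic if for every factor $x$ of $\omega$ there is $l$ such that every factor of $\omega$ of length $l$ contains an occurrence of $x$. It is eventually strongly almost periodic if some suffix $\omega[n,\infty)$ is strongly almost periodic. -}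

module Defs where

open import Data.Nat using (ℕ; zero; suc; _+_; _≤_)
open import Data.Bool using (Bool)
open import Data.List using (List; []; _∷_; length)
open import Data.Product using (Σ; ∃; _×_; _,_)
open import Relation.Binary.PropositionalEquality using (_≡_; _≢_)

Seq : Set
Seq = ℕ → Bool

window : Seq → ℕ → ℕ → List Bool
window ω i zero    = []
window ω i (suc l) = ω i ∷ window ω (suc i) l

OccursAt : Seq → List Bool → ℕ → Set
OccursAt ω x i = window ω i (length x) ≡ x

Factor : Seq → List Bool → Set
Factor ω x = (x ≢ []) × ∃ λ i → OccursAt ω x i

OccursInfinitelyOften : Seq → List Bool → Set
OccursInfinitelyOften ω x = ∀ N → ∃ λ i → N ≤ i × OccursAt ω x i

EveryFactorOfLengthContains : Seq → ℕ → List Bool → Set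
EveryFactorOfLengthContains ω l x =
  ∀ i → ∃ λ j → i ≤ j × (j + length x ≤ i + l) × OccursAt ω x j

AlmostPeriodic : Seq → Set
AlmostPeriodic ω =
  ∀ x → Factor ω x → OccursInfinitelyOften ω x →
  ∃ λ l → EveryFactorOfLengthContains ω l x

StronglyAlmostPeriodic : Seq → Set
StronglyAlmostPeriodic ω =
  ∀ x → Factor ω x → ∃ λ l → EveryFactorOfLengthContains ω l x

suffix : Seq → ℕ → Seq
suffix ω n k = ω (n + k)

EventuallyStronglyAlmostPeriodic : Seq → Set
EventuallyStronglyAlmostPeriodic ω = ∃ λ n → StronglyAlmostPeriodic (suffix ω n)

-- ω differs from the Toeplitz sequence oddValuation only at the powers of 4. An occurrence of
-- a factor at a position p no smaller than its length L covers at most one power of two, 2 ^ t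
-- with 2 ^ t ≤ p + L < 2 ^ (1 + t); shifting it by a suitable multiple of 2 ^ t gives a copy of
-- the same word inside the Toeplitz sequence and away from all powers of two, and that copy then
-- recurs in ω with every period 2 ^ K beyond it. So factors occurring infinitely often occur
-- syndetically. On the other hand the window of length 2 * 4 ^ n at 4 ^ n, a factor of the suffix
-- from n, records the defect at 4 ^ n together with enough of the Toeplitz pattern to rule out
-- every later position, so no suffix is strongly almost periodic.
module Submission where

open import Defs
open import Data.Bool using (Bool; true; false; not; if_then_else_)
open import Data.Bool.Properties using (not-¬)
open import Data.Empty using (⊥-elim)
open import Data.List using ([]; _∷_; length)
open import Data.List.Properties using (∷-injective)
open import Data.Nat
open import Data.Nat.DivMod using (_/_; _%_; m≡m%n+[m/n]*n; m%n<n; m/n*n≤m)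
open import Data.Nat.Induction using (<-rec)
open import Data.Nat.Properties
open import Data.Nat.Tactic.RingSolver using (solve-∀)
open import Data.Product using (∃; ∃₂; _×_; _,_; proj₁; proj₂; map₁)
open import Data.Sum using (_⊎_; inj₁; inj₂)
open import Function using (_∘_)
open import Relation.Binary.Definitions using (tri<; tri≈; tri>)
open import Relation.Binary.PropositionalEquality
open import Relation.Nullary using (¬_; yes; no)

odd : ℕ → Bool
odd zero    = false
odd (suc n) = not (odd n)

odd-2* : ∀ n → odd (2 * n) ≡ false
odd-2* zero = refl
odd-2* (suc n) = trans (cong odd (*-suc 2 n)) (cong (not ∘ not) (odd-2* n))

⌊2*n/2⌋≡n : ∀ n → ⌊ 2 * n /2⌋ ≡ n
⌊2*n/2⌋≡n zero    = refl
⌊2*n/2⌋≡n (suc n) = trans (cong ⌊_/2⌋ (*-suc 2 n)) (cong suc (⌊2*n/2⌋≡n n))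

⌊1+2*n/2⌋≡n : ∀ n → ⌊ suc (2 * n) /2⌋ ≡ n
⌊1+2*n/2⌋≡n zero    = refl
⌊1+2*n/2⌋≡n (suc n) = trans (cong (⌊_/2⌋ ∘ suc) (*-suc 2 n)) (cong suc (⌊1+2*n/2⌋≡n n))

even-or-odd : ∀ n → (∃ λ z → n ≡ 2 * z) ⊎ (∃ λ z → n ≡ suc (2 * z))
even-or-odd zero = inj₁ (0 , refl)
even-or-odd (suc n) with even-or-odd n
... | inj₁ (z , refl) = inj₂ (z , refl)
... | inj₂ (z , refl) = inj₁ (suc z , sym (*-suc 2 z))

n<2^n : ∀ n → n < 2 ^ n
n<2^n zero    = z<s
n<2^n (suc n) = ≤-<-trans (n<2^n n) (^-monoʳ-< 2 (s<s z<s) (n<1+n n))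

2^-split : ∀ {m n} → m ≤ n → ∃ λ r → 2 ^ n ≡ 2 ^ m * 2 ^ r
2^-split {m} m≤n with m≤n⇒∃[o]m+o≡n m≤n
... | r , refl = r , ^-distribˡ-+-* 2 m r

2^-cancel-< : ∀ {m n} → 2 ^ m < 2 ^ n → m < n
2^-cancel-< 2^m<2^n = ≰⇒> λ n≤m → <⇒≱ 2^m<2^n (^-monoʳ-≤ 2 n≤m)

data Dyadic : ℕ → Set where
  dyadic-form : ∀ s w → Dyadic (2 ^ s * suc (2 * w))

toDyadic : ∀ {m} → 1 ≤ m → Dyadic m
toDyadic {suc m} _ = <-rec (Dyadic ∘ suc) step m
  where
  double : ∀ {n} → Dyadic n → Dyadic (2 * n)
  double (dyadic-form s w) = subst Dyadic (*-assoc 2 (2 ^ s) _) (dyadic-form (suc s) w)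
  step : ∀ n → (∀ {k} → k < n → Dyadic (suc k)) → Dyadic (suc n)
  step n rec with even-or-odd (suc n)
  ... | inj₂ (w , eq) = subst Dyadic (trans (+-identityʳ _) (sym eq)) (dyadic-form 0 w)
  ... | inj₁ (suc k , eq) = subst Dyadic (sym eq) (double (rec k<n))
    where
    k<n : k < n
    k<n = subst (k <_) (sym (suc-injective (trans eq (*-suc 2 k)))) (s≤s (m≤m+n k _))

-- dyadic′ f m = (s , w) with m = 2 ^ s * (2 * w + 1), provided the fuel f exceeds s.
dyadic′ : ℕ → ℕ → ℕ × ℕ
dyadic′ zero    m = 0 , 0
dyadic′ (suc f) m = if odd m then (0 , ⌊ m /2⌋) else map₁ suc (dyadic′ f ⌊ m /2⌋)

dyadic′-odd : ∀ f w → dyadic′ (suc f) (suc (2 * w)) ≡ (0 , w)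
dyadic′-odd f w rewrite odd-2* w | ⌊1+2*n/2⌋≡n w = refl

dyadic′-even : ∀ f n → dyadic′ (suc f) (2 * n) ≡ map₁ suc (dyadic′ f n)
dyadic′-even f n rewrite odd-2* n | ⌊2*n/2⌋≡n n = refl

dyadic′-correct : ∀ {f} s w → s < f → dyadic′ f (2 ^ s * suc (2 * w)) ≡ (s , w)
dyadic′-correct {suc f} zero w _ =
  trans (cong (dyadic′ (suc f)) (*-identityˡ (suc (2 * w)))) (dyadic′-odd f w)
dyadic′-correct {suc f} (suc s) w (s≤s s<f) = begin
  dyadic′ (suc f) (2 * 2 ^ s * suc (2 * w))   ≡⟨ cong (dyadic′ (suc f)) (*-assoc 2 (2 ^ s) _) ⟩
  dyadic′ (suc f) (2 * (2 ^ s * suc (2 * w))) ≡⟨ dyadic′-even f _ ⟩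
  map₁ suc (dyadic′ f (2 ^ s * suc (2 * w)))  ≡⟨ cong (map₁ suc) (dyadic′-correct s w s<f) ⟩
  (suc s , w)                                 ∎
  where open ≡-Reasoning

dyadic : ℕ → ℕ × ℕ
dyadic m = dyadic′ m m

dyadic-correct : ∀ s w → dyadic (2 ^ s * suc (2 * w)) ≡ (s , w)
dyadic-correct s w = dyadic′-correct s w (<-≤-trans (n<2^n s) (m≤m*n (2 ^ s) (suc (2 * w))))

oddValuation : Seq
oddValuation m = odd (proj₁ (dyadic m))

-- ω agrees with oddValuation except at the powers of 4, where it is true instead of false.
ω : Seq
ω m with dyadic m
... | _ , zero  = true
... | s , suc _ = odd s

oddValuation-dyadic : ∀ s w → oddValuation (2 ^ s * suc (2 * w)) ≡ odd s
oddValuation-dyadic s w rewrite dyadic-correct s w = refl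

ω-power : ∀ s → ω (2 ^ s * 1) ≡ true
ω-power s rewrite dyadic-correct s 0 = refl

ω-dyadic : ∀ s {w} → 1 ≤ w → ω (2 ^ s * suc (2 * w)) ≡ odd s
ω-dyadic s {suc w} _ rewrite dyadic-correct s (suc w) = refl

2^s≤dyadic : ∀ s w → 2 ^ s ≤ 2 ^ s * suc (2 * w)
2^s≤dyadic s w = m≤m*n (2 ^ s) (suc (2 * w))

2^1+s≤dyadic : ∀ s w → 2 ^ suc s ≤ 2 ^ s * suc (2 * suc w)
2^1+s≤dyadic s w = begin
  2 * 2 ^ s                  ≡⟨ *-comm 2 (2 ^ s) ⟩
  2 ^ s * 2                  ≤⟨ *-monoʳ-≤ (2 ^ s) (s≤s (s≤s z≤n)) ⟩
  2 ^ s * suc (2 * suc w)    ∎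
  where open ≤-Reasoning

dyadic-shift : ∀ {s K} w y → s < K →
               ∃ λ r → 2 ^ s * suc (2 * w) + y * 2 ^ K ≡ 2 ^ s * suc (2 * (w + y * 2 ^ r))
dyadic-shift {s} {K} w y s<K with 2^-split s<K
... | r , 2^K≡ = r , (begin
  2 ^ s * suc (2 * w) + y * 2 ^ K                 ≡⟨ cong (λ P → 2 ^ s * suc (2 * w) + y * P) 2^K≡ ⟩
  2 ^ s * suc (2 * w) + y * (2 * 2 ^ s * 2 ^ r)   ≡⟨ distrib (2 ^ s) w y (2 ^ r) ⟩
  2 ^ s * suc (2 * (w + y * 2 ^ r))               ∎)
  where
  open ≡-Reasoning
  distrib : ∀ X w y Z → X * suc (2 * w) + y * (2 * X * Z) ≡ X * suc (2 * (w + y * Z))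
  distrib = solve-∀

oddValuation-shift : ∀ {s K} w y → s < K → oddValuation (2 ^ s * suc (2 * w) + y * 2 ^ K) ≡ odd s
oddValuation-shift {s} w y s<K =
  let r , eq = dyadic-shift w y s<K in
  trans (cong oddValuation eq) (oddValuation-dyadic s (w + y * 2 ^ r))

ω-shift : ∀ {s K} w y → s < K → 1 ≤ w + y → ω (2 ^ s * suc (2 * w) + y * 2 ^ K) ≡ odd s
ω-shift {s} w y s<K 1≤w+y =
  let r , eq = dyadic-shift w y s<K in
  trans (cong ω eq) (ω-dyadic s (≤-trans 1≤w+y (+-monoʳ-≤ w (m≤m*n y (2 ^ r) ⦃ m^n≢0 2 r ⦄))))

dyadic<2^⇒ : ∀ {s K} w → 2 ^ s * suc (2 * w) < 2 ^ K → s < K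
dyadic<2^⇒ {s} w q<2^K = 2^-cancel-< (≤-<-trans (2^s≤dyadic s w) q<2^K)

ω-periodic : ∀ {q K y} → 1 ≤ q → q < 2 ^ K → 1 ≤ y → ω (q + y * 2 ^ K) ≡ oddValuation q
ω-periodic {K = K} {y} 1≤q q<2^K 1≤y with toDyadic 1≤q
... | dyadic-form s w =
  trans (ω-shift {s} {K} w y (dyadic<2^⇒ w q<2^K) (≤-trans 1≤y (m≤n+m y w)))
        (sym (oddValuation-dyadic s w))

window-cong : ∀ {f g : Seq} {i j} L → (∀ e → e < L → f (i + e) ≡ g (j + e)) →
              window f i L ≡ window g j L
window-cong zero _ = refl
window-cong {f} {g} {i} {j} (suc L) f≗g = cong₂ _∷_ first (window-cong L rest)
  where
  first : f i ≡ g j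
  first = subst₂ (λ a b → f a ≡ g b) (+-identityʳ i) (+-identityʳ j) (f≗g 0 z<s)
  rest : ∀ e → e < L → f (suc i + e) ≡ g (suc j + e)
  rest e e<L = subst₂ (λ a b → f a ≡ g b) (+-suc i e) (+-suc j e) (f≗g (suc e) (s<s e<L))

window-pointwise : ∀ {f g : Seq} {i j} L → window f i L ≡ window g j L →
                   ∀ e → e < L → f (i + e) ≡ g (j + e)
window-pointwise {f} {g} {i} {j} (suc L) eq zero _ =
  subst₂ (λ a b → f a ≡ g b) (sym (+-identityʳ i)) (sym (+-identityʳ j)) (proj₁ (∷-injective eq))
window-pointwise {f} {g} {i} {j} (suc L) eq (suc e) (s<s e<L) =
  subst₂ (λ a b → f a ≡ g b) (sym (+-suc i e)) (sym (+-suc j e))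
         (window-pointwise L (proj₂ (∷-injective eq)) e e<L)

length-window : ∀ (f : Seq) i L → length (window f i L) ≡ L
length-window f i zero    = refl
length-window f i (suc L) = cong suc (length-window f (suc i) L)

window-nonempty : ∀ (f : Seq) i {L} → 1 ≤ L → window f i L ≢ []
window-nonempty f i {suc L} _ ()

window-occurs : ∀ {f g : Seq} {i j} L → (∀ e → e < L → f (j + e) ≡ g (i + e)) →
                OccursAt f (window g i L) j
window-occurs {g = g} {i} L f≗g rewrite length-window g i L = window-cong L f≗g

occurs-window : ∀ {f g : Seq} {i j} L → OccursAt f (window g i L) j →
                ∀ e → e < L → f (j + e) ≡ g (i + e)
occurs-window {g = g} {i} L occ rewrite length-window g i L = window-pointwise L occ

progression⇒syndetic : ∀ {f : Seq} {x} a d .{{_ : NonZero d}} →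
                       (∀ n → OccursAt f x (a + suc n * d)) →
                       EveryFactorOfLengthContains f (a + d + length x) x
progression⇒syndetic {x = x} a d occ i = a + suc (i / d) * d , i≤j , j+|x|≤ , occ (i / d)
  where
  i<[1+i/d]*d : i < suc (i / d) * d
  i<[1+i/d]*d = begin-strict
    i                  ≡⟨ m≡m%n+[m/n]*n i d ⟩
    i % d + i / d * d  <⟨ +-monoˡ-< (i / d * d) (m%n<n i d) ⟩
    d + i / d * d      ∎
    where open ≤-Reasoning
  i≤j : i ≤ a + suc (i / d) * d
  i≤j = ≤-trans (<⇒≤ i<[1+i/d]*d) (m≤n+m _ a)
  regroup : ∀ a d q x → a + (d + q) + x ≡ q + (a + d + x)
  regroup = solve-∀
  j+|x|≤ : a + suc (i / d) * d + length x ≤ i + (a + d + length x)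
  j+|x|≤ = ≤-trans (≤-reflexive (regroup a d (i / d * d) (length x)))
                   (+-monoˡ-≤ (a + d + length x) (m/n*n≤m i d))

power-of-two-bracket : ∀ {m} → 1 ≤ m → ∃ λ t → 2 ^ t ≤ m × m < 2 ^ suc t
power-of-two-bracket {suc zero} _ = 0 , ≤-refl , s<s z<s
power-of-two-bracket {suc (suc m)} _ with power-of-two-bracket {suc m} (s≤s z≤n)
... | t , lower , upper with suc (suc m) <? 2 ^ suc t
...   | yes upper′ = t , m≤n⇒m≤1+n lower , upper′
...   | no ¬upper′ = suc t , ≤-reflexive (sym 2+m≡2^1+t) , 2+m<2^2+t
  where
  2+m≡2^1+t : suc (suc m) ≡ 2 ^ suc t
  2+m≡2^1+t = ≤-antisym upper (≮⇒≥ ¬upper′)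
  2+m<2^2+t : suc (suc m) < 2 ^ suc (suc t)
  2+m<2^2+t = subst (_< 2 ^ suc (suc t)) (sym 2+m≡2^1+t) (^-monoʳ-< 2 (s<s z<s) (n<1+n (suc t)))

-- Adding y * 2 ^ t to 2 ^ t gives 2 ^ (1 + t) or 3 * 2 ^ t, one of which has odd valuation.
odd-valued-multiple : ∀ t → ∃ λ y → oddValuation (2 ^ t * suc y) ≡ true
odd-valued-multiple t with odd t in t-odd
... | true  = 0 , trans (oddValuation-dyadic t 0) t-odd
... | false = 1 , (begin
  oddValuation (2 ^ t * 2)       ≡⟨ cong oddValuation (trans (*-comm (2 ^ t) 2) (sym (*-identityʳ _))) ⟩
  oddValuation (2 ^ suc t * 1)   ≡⟨ oddValuation-dyadic (suc t) 0 ⟩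
  not (odd t)                    ≡⟨ cong not t-odd ⟩
  true                           ∎)
  where open ≡-Reasoning

-- Since L < p, the only power of two in [p, p + L] can be 2 ^ t, and the shift repairs it.
oddValuation-shift≡ω : ∀ {p L t y q} → L < p → 2 ^ t ≤ p + L → p + L < 2 ^ suc t →
                       oddValuation (2 ^ t * suc y) ≡ true → p ≤ q → q ≤ p + L →
                       oddValuation (q + y * 2 ^ t) ≡ ω q
oddValuation-shift≡ω {p} {L} {t} {y} L<p 2^t≤p+L p+L<2^1+t repaired p≤q q≤p+L
  with toDyadic (≤-trans (≤-trans z<s L<p) p≤q)
... | dyadic-form s w with <-cmp s t | w
... | tri< s<t _ _ | zero = ⊥-elim (<-irrefl refl (begin-strict
  p + L                      <⟨ +-monoʳ-< p L<p ⟩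
  p + p                      ≤⟨ +-mono-≤ p≤q p≤q ⟩
  2 ^ s * 1 + 2 ^ s * 1      ≡⟨ double (2 ^ s) ⟩
  2 ^ suc s                  ≤⟨ ^-monoʳ-≤ 2 s<t ⟩
  2 ^ t                      ≤⟨ 2^t≤p+L ⟩
  p + L                      ∎))
  where
  open ≤-Reasoning
  double : ∀ X → X * 1 + X * 1 ≡ 2 * X
  double = solve-∀
... | tri< s<t _ _ | suc w′ = trans (oddValuation-shift (suc w′) y s<t) (sym (ω-dyadic s (s≤s z≤n)))
... | tri≈ _ refl _ | zero = begin
  oddValuation (2 ^ t * 1 + y * 2 ^ t)  ≡⟨ cong oddValuation (regroup (2 ^ t) y) ⟩
  oddValuation (2 ^ t * suc y)          ≡⟨ repaired ⟩
  true                                  ≡⟨ ω-power t ⟨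
  ω (2 ^ t * 1)                         ∎
  where
  open ≡-Reasoning
  regroup : ∀ X y → X * 1 + y * X ≡ X * suc y
  regroup = solve-∀
... | tri≈ _ refl _ | suc w′ =
  ⊥-elim (<-irrefl refl (≤-<-trans (≤-trans (2^1+s≤dyadic t w′) q≤p+L) p+L<2^1+t))
... | tri> _ _ t<s | w′ =
  ⊥-elim (<-irrefl refl
    (≤-<-trans (≤-trans (^-monoʳ-≤ 2 t<s) (≤-trans (2^s≤dyadic s w′) q≤p+L)) p+L<2^1+t))

late-window-recurs : ∀ p L → L < p →
                     ∃₂ λ a K → ∀ n → window ω (a + suc n * 2 ^ K) (suc L) ≡ window ω p (suc L)
late-window-recurs p L L<p with power-of-two-bracket (≤-trans (≤-trans z<s L<p) (m≤m+n p L))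
... | t , 2^t≤p+L , p+L<2^1+t with odd-valued-multiple t
... | y , repaired = a , a + L , λ n → window-cong (suc L) (agree n)
  where
  a = p + y * 2 ^ t
  regroup₁ : ∀ p Y N e → p + Y + N + e ≡ p + e + Y + N
  regroup₁ = solve-∀
  regroup₂ : ∀ p Y e → p + e + Y ≡ p + Y + e
  regroup₂ = solve-∀
  1≤q : ∀ e → 1 ≤ p + e + y * 2 ^ t
  1≤q e = ≤-trans (≤-trans z<s L<p) (≤-trans (m≤m+n p e) (m≤m+n (p + e) _))
  q<2^K : ∀ e → e ≤ L → p + e + y * 2 ^ t < 2 ^ (a + L)
  q<2^K e e≤L = begin-strict
    p + e + y * 2 ^ t   ≡⟨ regroup₂ p (y * 2 ^ t) e ⟩
    a + e               ≤⟨ +-monoʳ-≤ a e≤L ⟩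
    a + L               <⟨ n<2^n (a + L) ⟩
    2 ^ (a + L)         ∎
    where open ≤-Reasoning
  agree : ∀ n e → e < suc L → ω (a + suc n * 2 ^ (a + L) + e) ≡ ω (p + e)
  agree n e e<1+L = begin
    ω (a + suc n * 2 ^ (a + L) + e)
      ≡⟨ cong ω (regroup₁ p (y * 2 ^ t) _ e) ⟩
    ω (p + e + y * 2 ^ t + suc n * 2 ^ (a + L))
      ≡⟨ ω-periodic {K = a + L} {suc n} (1≤q e) (q<2^K e (≤-pred e<1+L)) (s≤s z≤n) ⟩
    oddValuation (p + e + y * 2 ^ t)
      ≡⟨ oddValuation-shift≡ω {t = t} L<p 2^t≤p+L p+L<2^1+t repaired
                              (m≤m+n p e) (+-monoʳ-≤ p (≤-pred e<1+L)) ⟩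
    ω (p + e)
      ∎
    where open ≡-Reasoning

ω-almost-periodic : AlmostPeriodic ω
ω-almost-periodic []       (x≢[] , _) _     = ⊥-elim (x≢[] refl)
ω-almost-periodic (b ∷ xs) _          often =
  let p , |x|≤p , occ = often (length (b ∷ xs))
      a , K , recurs  = late-window-recurs p (length xs) |x|≤p
  in  _ , progression⇒syndetic a (2 ^ K) ⦃ m^n≢0 2 K ⦄ (λ n → trans (recurs n) occ)

≢-by-parity : ∀ {b c d} → c ≡ not b → d ≡ b → c ≢ d
≢-by-parity c≡¬b d≡b c≡d = not-¬ refl (trans (sym d≡b) (trans (sym c≡d) c≡¬b))

2^n<2*2^n : ∀ n → 2 ^ n < 2 * 2 ^ n
2^n<2*2^n n = ^-monoʳ-< 2 (s<s z<s) (n<1+n n)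

WindowMismatch : ℕ → ℕ → Set
WindowMismatch k a = ∃ λ e → e < 2 * 2 ^ k × ω (a + e) ≢ ω (2 ^ k + e)

-- One of a + 2 ^ s, a + 3 * 2 ^ s has valuation exactly 1 + s, while 2 ^ k + 2 ^ s and
-- 2 ^ k + 3 * 2 ^ s have valuation s.
mismatch-below : ∀ {s k} u → s < k → 2 ^ k < 2 ^ s * suc (2 * u) →
                 WindowMismatch k (2 ^ s * suc (2 * u))
mismatch-below {s} {k} u s<k 2^k<a with 2^-split s<k | even-or-odd u
... | r , 2^k≡ | inj₁ (zero , refl) =
  ⊥-elim (<-asym 2^k<a (subst (_< 2 ^ k) (sym (*-identityʳ (2 ^ s))) (^-monoʳ-< 2 (s<s z<s) s<k)))
... | r , 2^k≡ | inj₁ (suc z , refl) =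
  2 ^ s , <-trans (^-monoʳ-< 2 (s<s z<s) s<k) (2^n<2*2^n k) , ≢-by-parity left right
  where
  left : ω (2 ^ s * suc (2 * (2 * suc z)) + 2 ^ s) ≡ not (odd s)
  left = trans (cong ω (regroup (2 ^ s) (suc z))) (ω-dyadic (suc s) (s≤s z≤n))
    where
    regroup : ∀ X z → X * suc (2 * (2 * z)) + X ≡ 2 * X * suc (2 * z)
    regroup = solve-∀
  right : ω (2 ^ k + 2 ^ s) ≡ odd s
  right = trans (cong ω (trans (cong (_+ 2 ^ s) 2^k≡) (regroup (2 ^ s) (2 ^ r))))
                (ω-shift {s} {suc s} 0 (2 ^ r) (n<1+n s) (m^n>0 2 r))
    where
    regroup : ∀ X R → 2 * X * R + X ≡ X * 1 + R * (2 * X)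
    regroup = solve-∀
... | r , 2^k≡ | inj₂ (z , refl) = 3 * 2 ^ s , 3*2^s<2*2^k , ≢-by-parity left right
  where
  left : ω (2 ^ s * suc (2 * suc (2 * z)) + 3 * 2 ^ s) ≡ not (odd s)
  left = trans (cong ω (regroup (2 ^ s) z)) (ω-dyadic (suc s) (s≤s z≤n))
    where
    regroup : ∀ X z → X * suc (2 * suc (2 * z)) + 3 * X ≡ 2 * X * suc (2 * suc z)
    regroup = solve-∀
  right : ω (2 ^ k + 3 * 2 ^ s) ≡ odd s
  right = trans (cong ω (trans (cong (_+ 3 * 2 ^ s) 2^k≡) (regroup (2 ^ s) (2 ^ r))))
                (ω-shift {s} {suc s} 0 (1 + 2 ^ r) (n<1+n s) (s≤s z≤n))
    where
    regroup : ∀ X R → 2 * X * R + 3 * X ≡ X * 1 + (1 + R) * (2 * X)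
    regroup = solve-∀
  3*2^s<2*2^k : 3 * 2 ^ s < 2 * 2 ^ k
  3*2^s<2*2^k = begin-strict
    3 * 2 ^ s                 <⟨ *-monoˡ-< (2 ^ s) ⦃ m^n≢0 2 s ⦄ (n<1+n 3) ⟩
    4 * 2 ^ s                 ≤⟨ m≤m*n (4 * 2 ^ s) (2 ^ r) ⦃ m^n≢0 2 r ⦄ ⟩
    4 * 2 ^ s * 2 ^ r         ≡⟨ regroup (2 ^ s) (2 ^ r) ⟩
    2 * (2 * 2 ^ s * 2 ^ r)   ≡⟨ cong (2 *_) 2^k≡ ⟨
    2 * 2 ^ k                 ∎
    where
    open ≤-Reasoning
    regroup : ∀ X R → 4 * X * R ≡ 2 * (2 * X * R)
    regroup = solve-∀

mismatch-at : ∀ {k} u → odd k ≡ false → 2 ^ k < 2 ^ k * suc (2 * u) →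
              WindowMismatch k (2 ^ k * suc (2 * u))
mismatch-at {k} zero _ 2^k<2^k*1 = ⊥-elim (<-irrefl (sym (*-identityʳ (2 ^ k))) 2^k<2^k*1)
mismatch-at {k} (suc u) k-even _ = 0 , m^n>0 2 (suc k) , ≢-by-parity {true} left right
  where
  left : ω (2 ^ k * suc (2 * suc u) + 0) ≡ not true
  left = trans (cong ω (+-identityʳ (2 ^ k * suc (2 * suc u)))) (trans (ω-dyadic k (s≤s z≤n)) k-even)
  right : ω (2 ^ k + 0) ≡ true
  right = trans (cong ω (trans (+-identityʳ (2 ^ k)) (sym (*-identityʳ (2 ^ k))))) (ω-power k)

mismatch-above : ∀ {s k} u → odd k ≡ false → k < s → WindowMismatch k (2 ^ s * suc (2 * u))
mismatch-above {s} {k} u k-even k<s with 2^-split k<s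
... | r , 2^s≡ = 2 ^ k , 2^n<2*2^n k , ≢-by-parity {true} left right
  where
  y = 2 ^ r * suc (2 * u)
  1≤y : 1 ≤ y
  1≤y = ≤-trans (m^n>0 2 r) (m≤m*n (2 ^ r) (suc (2 * u)))
  left : ω (2 ^ s * suc (2 * u) + 2 ^ k) ≡ not true
  left = trans (cong ω (trans (cong (λ P → P * suc (2 * u) + 2 ^ k) 2^s≡) (regroup (2 ^ k) (2 ^ r) u)))
               (trans (ω-shift {k} {suc k} 0 y (n<1+n k) 1≤y) k-even)
    where
    regroup : ∀ X R u → 2 * X * R * suc (2 * u) + X ≡ X * 1 + R * suc (2 * u) * (2 * X)
    regroup = solve-∀
  right : ω (2 ^ k + 2 ^ k) ≡ true
  right = trans (cong ω (regroup (2 ^ k))) (ω-power (suc k))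
    where
    regroup : ∀ X → X + X ≡ 2 * X * 1
    regroup = solve-∀

-- For k = 2 * n: the window ω[4 ^ n, 3 * 4 ^ n) occurs nowhere after position 4 ^ n.
window-after-power-mismatch : ∀ {k a} → odd k ≡ false → 2 ^ k < a → WindowMismatch k a
window-after-power-mismatch {k} k-even 2^k<a with toDyadic (≤-trans (m^n>0 2 k) (<⇒≤ 2^k<a))
... | dyadic-form s u with <-cmp s k
... | tri< s<k _ _  = mismatch-below u s<k 2^k<a
... | tri≈ _ refl _ = mismatch-at {k} u k-even 2^k<a
... | tri> _ _ k<s  = mismatch-above u k-even k<s

ω-not-eventually-strongly-almost-periodic : ¬ EventuallyStronglyAlmostPeriodic ω
ω-not-eventually-strongly-almost-periodic (n , sap) =
  let i₀ , n+i₀≡P          = m≤n⇒∃[o]m+o≡n n≤P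
      _ , every            = sap x (window-nonempty ω P (m^n>0 2 (suc k)) , i₀ , x-at i₀ n+i₀≡P)
      j , 1+P≤j , _ , x-at-j = every (suc P)
      e , e<2P , differs   = window-after-power-mismatch {k} (odd-2* n) (≤-trans 1+P≤j (m≤n+m j n))
  in  differs (trans (cong ω (+-assoc n j e)) (occurs-window (2 * P) x-at-j e e<2P))
  where
  k = 2 * n
  P = 2 ^ k
  x = window ω P (2 * P)
  n≤P : n ≤ P
  n≤P = ≤-trans (<⇒≤ (n<2^n n)) (^-monoʳ-≤ 2 (m≤n*m n 2))
  x-at : ∀ i → n + i ≡ P → OccursAt (suffix ω n) x i
  x-at i n+i≡P = window-occurs (2 * P) λ e _ → cong ω (trans (sym (+-assoc n i e)) (cong (_+ e) n+i≡P))

theorem1 : ∃ λ (ω : Seq) → AlmostPeriodic ω × ¬ EventuallyStronglyAlmostPeriodic ω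
theorem1 = ω , ω-almost-periodic , ω-not-eventually-strongly-almost-periodic
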